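{- Let $G=(X,Y,E)$ be a 2-layer network in which every vertex of $Y$ has degree at least $1$, and let $<_X$ be a linear order of $X$ such that the one-sided local crossing number of $(G,<_X)$ is $k$. Then every order $<_{\mathsf A}$ of $Y$ that can be returned by heuristic $\mathsf A$ (defined in the context) yields a 2-layer drawing $(<_X,<_{\mathsf A})$ whose local crossing number is at most $3k$.
   Context: A 2-layer network $(X,Y,E)$ is a finite bipartite graph with vertex set $X\cup Y$, $X\cap Y=\emptyset$, edges written $(x,y)$ with $x\in X,y\in Y$. A 2-layer drawing is a pair $(<_X,<_Y)$ of linear orders of $X$ and $Y$; edges $(x_1,y_1),(x_2,y_2)$ cross iff $(x_1<_X x_2\wedge y_2<_Y y_1)$ or $(x_2<_X x_1\wedge y_1<_Y y_2)$. The local crossing number of a drawing is the minimum $k$ such that every edge crosses at most $k$ edges. The one-sided local crossing number of $(G,<_X)$ is the minimum over all linear orders $<_Y$ of $Y$ of the local crossing number of $(<_X,<_Y)$. Heuristic $\mathsf A$: for each $y\in Y$ list its neighbors in increasing $<_X$ order (1-indexed). The median $\mathrm{med}(y)$ is the 2nd neighbor if $\deg(y)=2$, and the $\lfloor \deg(y)/2\rfloor$-th neighbor if $\deg(y)\neq 2$. Call $y$ a 2-vertex if $\deg(y)=2$, an odd vertex if $\deg(y)$ is odd, and a $4^{\oplus}$-vertex if $\deg(y)$ is even and at least $4$. For a 2-vertex $y$, its heavy neighbor is its neighbor other than $\mathrm{med}(y)$. The bunch of $x\in X$ is $\{y\in Y:\mathrm{med}(y)=x\}$. The output $<_{\mathsf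 A}$ is a linear order of $Y$ with $y_1<_{\mathsf A}y_2$ whenever $\mathrm{med}(y_1)<_X\mathrm{med}(y_2)$, and within each bunch: first the 2-vertices in ascending $<_X$-order of their heavy neighbors (ties broken arbitrarily), then the odd vertices in any order, then the $4^{\oplus}$-vertices in ascending order of degree (ties broken arbitrarily). -}

module Defs where

open import Data.Bool using (Bool; true; false; _∧_; _∨_; T)
open import Data.Nat using (ℕ; zero; suc; _≤_; _<_; _<ᵇ_; _≤ᵇ_; _⊔_; _/_; _+_)
open import Data.Fin using (Fin; toℕ)
open import Data.Fin.Permutation using (Permutation′; _⟨$⟩ʳ_)
open import Data.List using (List; length; filterᵇ; cartesianProduct; allFin; foldr)
open import Data.Product using (_×_; _,_; ∃; proj₁; proj₂)
open import Relation.Nullary using (¬_)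
open import Relation.Binary.PropositionalEquality using (_≡_; _≢_)

-- A 2-layer network: X = Fin m, Y = Fin n, edge relation E x y (Bool-valued).
Network : ℕ → ℕ → Set
Network m n = Fin m → Fin n → Bool

-- A linear order of Fin k, given by a bijective rank function (permutation):
-- a <[ π ] b  iff  rank π a < rank π b.
LinOrder : ℕ → Set
LinOrder k = Permutation′ k

rank : ∀ {k} → LinOrder k → Fin k → ℕ
rank π a = toℕ (π ⟨$⟩ʳ a)

_<ᵇ[_]_ : ∀ {k} → Fin k → LinOrder k → Fin k → Bool
a <ᵇ[ π ] b = rank π a <ᵇ rank π b

_≤ᵇ[_]_ : ∀ {k} → Fin k → LinOrder k → Fin k → Bool
a ≤ᵇ[ π ] b = rank π a ≤ᵇ rank π b

_<[_]_ : ∀ {k} → Fin k → LinOrder k → Fin k → Set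
a <[ π ] b = rank π a < rank π b

module _ {m n : ℕ} (E : Network m n) where

  pairs : List (Fin m × Fin n)
  pairs = cartesianProduct (allFin m) (allFin n)

  edges : List (Fin m × Fin n)
  edges = filterᵇ (λ e → E (proj₁ e) (proj₂ e)) pairs

  crosses : LinOrder m → LinOrder n → Fin m × Fin n → Fin m × Fin n → Bool
  crosses πX πY (x₁ , y₁) (x₂ , y₂) =
    (x₁ <ᵇ[ πX ] x₂ ∧ y₂ <ᵇ[ πY ] y₁) ∨ (x₂ <ᵇ[ πX ] x₁ ∧ y₁ <ᵇ[ πY ] y₂)

  crossCount : LinOrder m → LinOrder n → Fin m × Fin n → ℕ
  crossCount πX πY e = length (filterᵇ (crosses πX πY e) edges)

  -- local crossing number of the drawing (<X , <Y): the least k such that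
  -- every edge crosses at most k edges, i.e. the maximum of crossCount over edges
  -- (0 if there are no edges).
  localCrossingNumber : LinOrder m → LinOrder n → ℕ
  localCrossingNumber πX πY = foldr (λ e acc → crossCount πX πY e ⊔ acc) 0 edges

  OneSidedLCN : LinOrder m → ℕ → Set
  OneSidedLCN πX k =
    (∃ λ πY → localCrossingNumber πX πY ≡ k) × (∀ πY → k ≤ localCrossingNumber πX πY)

  deg : Fin n → ℕ
  deg y = length (filterᵇ (λ x → E x y) (allFin m))

  -- position (1-indexed) of neighbour x in the <X-sorted neighbour list of y:
  -- the number of neighbours x' of y with x' ≤X x.
  nbPos : LinOrder m → Fin n → Fin m → ℕ
  nbPos πX y x = length (filterᵇ (λ x' → E x' y ∧ (x' ≤ᵇ[ πX ] x)) (allFin m))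

  medIndex : ℕ → ℕ
  medIndex 2 = 2
  medIndex d = (d + 1) / 2

  IsMed : LinOrder m → Fin n → Fin m → Set
  IsMed πX y x = T (E x y) × nbPos πX y x ≡ medIndex (deg y)

  data Odd : ℕ → Set where
    odd1 : Odd 1
    oddSS : ∀ {d} → Odd d → Odd (suc (suc d))

  Is2 : Fin n → Set
  Is2 y = deg y ≡ 2

  IsOdd : Fin n → Set
  IsOdd y = Odd (deg y)

  Is4⊕ : Fin n → Set
  Is4⊕ y = ¬ Odd (deg y) × 4 ≤ deg y

  IsHeavy : LinOrder m → Fin n → Fin m → Set
  IsHeavy πX y h = Is2 y × T (E h y) × (∀ x → IsMed πX y x → h ≢ x)

  HeuristicAOutput : LinOrder m → LinOrder n → Set
  HeuristicAOutput πX πY =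
    ∀ y₁ y₂ x₁ x₂ → IsMed πX y₁ x₁ → IsMed πX y₂ x₂ →
      (x₁ <[ πX ] x₂ → y₁ <[ πY ] y₂)
      × (x₁ ≡ x₂ → Is2 y₁ → IsOdd y₂ → y₁ <[ πY ] y₂)
      × (x₁ ≡ x₂ → Is2 y₁ → Is4⊕ y₂ → y₁ <[ πY ] y₂)
      × (x₁ ≡ x₂ → IsOdd y₁ → Is4⊕ y₂ → y₁ <[ πY ] y₂)
      × (x₁ ≡ x₂ → ∀ h₁ h₂ → IsHeavy πX y₁ h₁ → IsHeavy πX y₂ h₂ →
           h₁ <[ πX ] h₂ → y₁ <[ πY ] y₂)
      × (x₁ ≡ x₂ → Is4⊕ y₁ → Is4⊕ y₂ → deg y₁ < deg y₂ → y₁ <[ πY ] y₂)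

{-# OPTIONS --safe #-}
module Submission where

open import Defs
open import Data.Nat
open import Data.Nat.DivMod using (m/n≡1+[m∸n]/n)
open import Data.Nat.Properties
open import Algebra.Properties.CommutativeMonoid.Sum +-0-commutativeMonoid
  using (sum; sum-cong-≗; sum-replicate-zero; ∑-distrib-+; ∑-comm)
open import Algebra.Properties.Semiring.Sum +-*-semiring using (*-distribˡ-sum)
open import Data.Bool using (Bool; true; false; _∧_; T)
open import Data.Bool.Properties using (T-∧; T-≡; ∧-identityʳ; ∧-zeroʳ; ∨-identityʳ)
open import Data.Empty using (⊥-elim)
open import Data.Fin using (Fin; zero; suc)
open import Data.Fin.Permutation using (_⟨$⟩ʳ_; _⟨$⟩ˡ_; inverseˡ)
open import Data.Fin.Properties using (toℕ-injective; toℕ<n) renaming (suc-injective to Fin-suc-injective)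
open import Data.List using (List; []; _∷_; _++_; map; length; filterᵇ; tabulate; cartesianProduct; foldr)
open import Data.List.Membership.Propositional using (_∈_)
open import Data.List.Membership.Propositional.Properties
  using (∈-filter⁺; ∈-filter⁻; ∈-cartesianProduct⁺; ∈-allFin)
open import Data.List.Relation.Unary.Any using (here; there)
open import Data.List.Properties using (length-++; filter-++; map-tabulate)
open import Data.Product using (_×_; _,_; ∃; proj₁; proj₂)
open import Data.Sum using (_⊎_; inj₁; inj₂)
open import Data.Unit using (tt)
open import Function using (_∘_; id)
open import Function.Bundles using (Equivalence)
open import Relation.Nullary using (¬_; Dec; yes; no)
open import Relation.Nullary.Decidable using (T?)
open import Relation.Binary.PropositionalEquality
open import Relation.Binary using (tri<; tri≈; tri>)

-- Fix an optimal order <O and an edge (a , y).  The edges at another vertex z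
-- that cross (a , y) are those at neighbours of z right of a if z is drawn
-- before y, and left of a if z is drawn after y.  Choose a neighbour c of y
-- on the other side of med(y) than a (see Companion).  Where <A and <O agree
-- on z versus y they produce the same crossings with z.  Where they disagree,
-- heuristic A has put med(z) on the matching side of med(y), or in the same
-- bunch in class order; since the median splits the neighbours of z almost
-- evenly, either the <A-crossings of (a , y) with z are at most its
-- <O-crossings with z, or deg z is at most twice the <O-crossings of (c , y)
-- with z.  Summing over z, (a , y) crosses at most k + 2k edges in <A.

-- Counting

ind : Bool → ℕ
ind true  = 1
ind false = 0

count : ∀ {k} → (Fin k → Bool) → ℕ
count p = sum (ind ∘ p)

sum-mono-≤ : ∀ {k} {f g : Fin k → ℕ} → (∀ i → f i ≤ g i) → sum f ≤ sum g
sum-mono-≤ {zero}  f≤g = z≤n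
sum-mono-≤ {suc k} f≤g = +-mono-≤ (f≤g zero) (sum-mono-≤ (f≤g ∘ suc))

sum-+-2* : ∀ {k} (f g : Fin k → ℕ) → sum (λ i → f i + 2 * g i) ≡ sum f + 2 * sum g
sum-+-2* f g = trans (∑-distrib-+ f (λ i → 2 * g i)) (cong (sum f +_) (sym (*-distribˡ-sum 2 g)))

count-mono : ∀ {k} {p q : Fin k → Bool} → (∀ i → T (p i) → T (q i)) → count p ≤ count q
count-mono p⇒q = sum-mono-≤ (λ i → ind-mono (p⇒q i))
  where
  ind-mono : ∀ {b c} → (T b → T c) → ind b ≤ ind c
  ind-mono {false}         _   = z≤n
  ind-mono {true} {true}   _   = ≤-refl
  ind-mono {true} {false} b⇒c = ⊥-elim (b⇒c tt)

count-witness : ∀ {k} (p : Fin k → Bool) i → T (p i) → 1 ≤ count p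
count-witness p zero    pi = ≤-trans (indT pi) (m≤m+n _ _)
  where
  indT : ∀ {b} → T b → 1 ≤ ind b
  indT {true} _ = ≤-refl
count-witness p (suc i) pi = ≤-trans (count-witness (p ∘ suc) i pi) (m≤n+m _ _)

count-positive : ∀ {k} (p : Fin k → Bool) → 1 ≤ count p → ∃ λ i → T (p i)
count-positive {zero}  p ()
count-positive {suc k} p 1≤count with p zero in p0
... | true  = zero , subst T (sym p0) tt
... | false with count-positive (p ∘ suc) 1≤count
...   | i , pi = suc i , pi

count-unique : ∀ {k} (p : Fin k → Bool) → (∀ i j → T (p i) → T (p j) → i ≡ j) → count p ≤ 1
count-unique {zero}  p unique = z≤n
count-unique {suc k} p unique with p zero in p0
... | true  = s≤s (≮⇒≥ only-zero)
  where
  only-zero : ¬ (0 < count (p ∘ suc))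
  only-zero 1≤count with count-positive (p ∘ suc) 1≤count
  ... | i , pi with unique (suc i) zero pi (subst T (sym p0) tt)
  ...   | ()
... | false = count-unique (p ∘ suc) (λ i j pi pj → Fin-suc-injective (unique (suc i) (suc j) pi pj))

count-∧-mono : ∀ {k} (p : Fin k → Bool) {q q′ : Fin k → Bool} → (∀ i → T (q i) → T (q′ i)) →
  count (λ i → p i ∧ q i) ≤ count (λ i → p i ∧ q′ i)
count-∧-mono p q⇒q′ = count-mono (λ i → ∧-monoʳ (p i) (q⇒q′ i))
  where
  ∧-monoʳ : ∀ b {c c′} → (T c → T c′) → T (b ∧ c) → T (b ∧ c′)
  ∧-monoʳ true c⇒c′ = c⇒c′

count-∧-witness : ∀ {k} (p q : Fin k → Bool) i → T (p i) → T (q i) → 1 ≤ count (λ i → p i ∧ q i)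
count-∧-witness p q i pi qi = count-witness _ i (Equivalence.from T-∧ (pi , qi))

count-∧-positive : ∀ {k} (p q : Fin k → Bool) → 1 ≤ count (λ i → p i ∧ q i) → ∃ λ i → T (p i) × T (q i)
count-∧-positive p q 1≤count with count-positive _ 1≤count
... | i , pqi = i , Equivalence.to T-∧ pqi

count-∧-split : ∀ {k} (p q₁ q₂ q : Fin k → Bool) → (∀ i → ind (q₁ i) + ind (q₂ i) ≡ ind (q i)) →
  count (λ i → p i ∧ q₁ i) + count (λ i → p i ∧ q₂ i) ≡ count (λ i → p i ∧ q i)
count-∧-split p q₁ q₂ q split =
  trans (sym (∑-distrib-+ (λ i → ind (p i ∧ q₁ i)) (λ i → ind (p i ∧ q₂ i))))
        (sum-cong-≗ (λ i → ∧-split (p i) (split i)))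
  where
  ∧-split : ∀ b {c₁ c₂ c} → ind c₁ + ind c₂ ≡ ind c → ind (b ∧ c₁) + ind (b ∧ c₂) ≡ ind (b ∧ c)
  ∧-split true  eq = eq
  ∧-split false eq = refl

filterᵇ-filterᵇ : ∀ {A : Set} (p q : A → Bool) (xs : List A) →
  filterᵇ q (filterᵇ p xs) ≡ filterᵇ (λ v → p v ∧ q v) xs
filterᵇ-filterᵇ p q [] = refl
filterᵇ-filterᵇ p q (x ∷ xs) with p x
... | false = filterᵇ-filterᵇ p q xs
... | true with q x
...   | true  = cong (x ∷_) (filterᵇ-filterᵇ p q xs)
...   | false = filterᵇ-filterᵇ p q xs

length-filterᵇ-tabulate : ∀ {A : Set} {k} (p : A → Bool) (f : Fin k → A) →
  length (filterᵇ p (tabulate f)) ≡ count (p ∘ f)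
length-filterᵇ-tabulate {k = zero}  p f = refl
length-filterᵇ-tabulate {k = suc k} p f with p (f zero)
... | true  = cong suc (length-filterᵇ-tabulate p (f ∘ suc))
... | false = length-filterᵇ-tabulate p (f ∘ suc)

length-filterᵇ-cartesianProduct : ∀ {A B : Set} {k l} (p : A × B → Bool) (f : Fin k → A) (g : Fin l → B) →
  length (filterᵇ p (cartesianProduct (tabulate f) (tabulate g))) ≡ sum (λ i → count (λ j → p (f i , g j)))
length-filterᵇ-cartesianProduct {k = zero}  p f g = refl
length-filterᵇ-cartesianProduct {k = suc k} p f g = begin
  length (filterᵇ p (row ++ rest))                  ≡⟨ cong length (filter-++ (T? ∘ p) row rest) ⟩
  length (filterᵇ p row ++ filterᵇ p rest)          ≡⟨ length-++ (filterᵇ p row) ⟩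
  length (filterᵇ p row) + length (filterᵇ p rest)
    ≡⟨ cong₂ _+_ (trans (cong (length ∘ filterᵇ p) (map-tabulate g (f zero ,_)))
                        (length-filterᵇ-tabulate p ((f zero ,_) ∘ g)))
                 (length-filterᵇ-cartesianProduct p (f ∘ suc) g) ⟩
  sum (λ i → count (λ j → p (f i , g j)))           ∎
  where
  open ≡-Reasoning
  row  = map (f zero ,_) (tabulate g)
  rest = cartesianProduct (tabulate (f ∘ suc)) (tabulate g)

foldr-⊔-lub : ∀ {A : Set} (f : A → ℕ) {b} xs → (∀ {x} → x ∈ xs → f x ≤ b) →
  foldr (λ x acc → f x ⊔ acc) 0 xs ≤ b
foldr-⊔-lub f []       _   = z≤n
foldr-⊔-lub f (x ∷ xs) ≤b = ⊔-lub (≤b (here refl)) (foldr-⊔-lub f xs (≤b ∘ there))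

foldr-⊔-upper : ∀ {A : Set} (f : A → ℕ) {x} xs → x ∈ xs → f x ≤ foldr (λ x acc → f x ⊔ acc) 0 xs
foldr-⊔-upper f (y ∷ xs) (here refl) = m≤m⊔n (f y) _
foldr-⊔-upper f (y ∷ xs) (there x∈xs) = ≤-trans (foldr-⊔-upper f xs x∈xs) (m≤n⊔m (f y) _)

≤ᵇ≡<ᵇ-suc : ∀ a b → (a ≤ᵇ b) ≡ (a <ᵇ suc b)
≤ᵇ≡<ᵇ-suc zero    b = refl
≤ᵇ≡<ᵇ-suc (suc a) b = refl

<ᵇ-zero : ∀ a → (a <ᵇ 0) ≡ false
<ᵇ-zero zero    = refl
<ᵇ-zero (suc a) = refl

<ᵇ-true : ∀ {a b} → a < b → (a <ᵇ b) ≡ true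
<ᵇ-true a<b = Equivalence.to T-≡ (<⇒<ᵇ a<b)

<ᵇ-false : ∀ {a b} → b ≤ a → (a <ᵇ b) ≡ false
<ᵇ-false {a} {b} b≤a with a <ᵇ b in a<ᵇb
... | false = refl
... | true  = ⊥-elim (≤⇒≯ b≤a (<ᵇ⇒< a b (subst T (sym a<ᵇb) tt)))

<ᵇ-suc-split : ∀ a b → ind (a <ᵇ b) + ind (a ≡ᵇ b) ≡ ind (a <ᵇ suc b)
<ᵇ-suc-split zero    zero    = refl
<ᵇ-suc-split zero    (suc b) = refl
<ᵇ-suc-split (suc a) zero    = cong ind (sym (<ᵇ-zero a))
<ᵇ-suc-split (suc a) (suc b) = <ᵇ-suc-split a b

<ᵇ-dichotomy : ∀ a b → ind (a <ᵇ b) + ind (b <ᵇ suc a) ≡ 1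
<ᵇ-dichotomy zero    zero    = refl
<ᵇ-dichotomy zero    (suc b) = cong (suc ∘ ind) (<ᵇ-zero b)
<ᵇ-dichotomy (suc a) zero    = refl
<ᵇ-dichotomy (suc a) (suc b) = <ᵇ-dichotomy a b

discrete-ivt : (f : ℕ → ℕ) → (∀ t → f (suc t) ≤ suc (f t)) →
  ∀ t {j} → f 0 < j → j ≤ f t → ∃ λ s → f s < j × f (suc s) ≡ j
discrete-ivt f step zero    f0<j j≤f0 = ⊥-elim (<⇒≱ f0<j j≤f0)
discrete-ivt f step (suc t) {j} f0<j j≤f[1+t] with j ≤? f t
... | yes j≤ft = discrete-ivt f step t f0<j j≤ft
... | no  j≰ft = t , ≰⇒> j≰ft , ≤-antisym (≤-trans (step t) (≰⇒> j≰ft)) j≤f[1+t]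

dichotomy-bound : ∀ {u v w d} → u ≤ d → u ≤ v ⊎ d ≤ 2 * w → u ≤ v + 2 * w
dichotomy-bound {v = v} _   (inj₁ u≤v)  = ≤-trans u≤v (m≤m+n v _)
dichotomy-bound {v = v} u≤d (inj₂ d≤2w) = ≤-trans u≤d (≤-trans d≤2w (m≤n+m _ v))

rank-injective : ∀ {k} (π : LinOrder k) {x y} → rank π x ≡ rank π y → x ≡ y
rank-injective π eq = trans (sym (inverseˡ π)) (trans (cong (π ⟨$⟩ˡ_) (toℕ-injective eq)) (inverseˡ π))

rank-≤⇒<⊎≡ : ∀ {k} (π : LinOrder k) {x y} → rank π x ≤ rank π y → x <[ π ] y ⊎ x ≡ y
rank-≤⇒<⊎≡ π x≤y with m≤n⇒m<n∨m≡n x≤y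
... | inj₁ x<y = inj₁ x<y
... | inj₂ x≈y = inj₂ (rank-injective π x≈y)

-- Median indices

⌈/2⌉-suc-suc : ∀ d → (suc (suc d) + 1) / 2 ≡ suc ((d + 1) / 2)
⌈/2⌉-suc-suc d = m/n≡1+[m∸n]/n {suc (suc d) + 1} (s≤s (s≤s z≤n))

module _ {m n : ℕ} (E : Network m n) where

  ⌈/2⌉-odd : ∀ {d} → Odd E d → (d + 1) / 2 + (d + 1) / 2 ≡ suc d
  ⌈/2⌉-odd odd1 = refl
  ⌈/2⌉-odd (oddSS {d} o) rewrite ⌈/2⌉-suc-suc d = cong suc (trans (+-suc _ _) (cong suc (⌈/2⌉-odd o)))

  ⌈/2⌉-even : ∀ d → ¬ Odd E d → (d + 1) / 2 + (d + 1) / 2 ≡ d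
  ⌈/2⌉-even zero          _    = refl
  ⌈/2⌉-even (suc zero)    ¬odd = ⊥-elim (¬odd odd1)
  ⌈/2⌉-even (suc (suc d)) ¬odd rewrite ⌈/2⌉-suc-suc d =
    cong suc (trans (+-suc _ _) (cong suc (⌈/2⌉-even d (¬odd ∘ oddSS))))

  odd? : ∀ d → Dec (Odd E d)
  odd? zero                = no (λ ())
  odd? (suc zero)          = yes odd1
  odd? (suc (suc d)) with odd? d
  ... | yes o = yes (oddSS o)
  ... | no ¬o = no (λ { (oddSS o) → ¬o o })

  medIndex-cases : ∀ d → 1 ≤ d →
    (d ≡ 2 × medIndex E d ≡ 2) ⊎
    (Odd E d × medIndex E d + medIndex E d ≡ suc d) ⊎
    ((¬ Odd E d × 4 ≤ d) × medIndex E d + medIndex E d ≡ d)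
  medIndex-cases (suc zero)          _ = inj₂ (inj₁ (odd1 , refl))
  medIndex-cases (suc (suc zero))    _ = inj₁ (refl , refl)
  medIndex-cases (suc (suc (suc d))) _ with odd? (3 + d)
  ... | yes o  = inj₂ (inj₁ (o , ⌈/2⌉-odd o))
  ... | no ¬o  = inj₂ (inj₂ ((¬o , four d ¬o) , ⌈/2⌉-even _ ¬o))
    where
    four : ∀ d → ¬ Odd E (3 + d) → 4 ≤ 3 + d
    four zero    ¬o = ⊥-elim (¬o (oddSS odd1))
    four (suc d) _  = s≤s (s≤s (s≤s (s≤s z≤n)))

  medIndex-bounds : ∀ d → 1 ≤ d → 1 ≤ medIndex E d × medIndex E d ≤ d
  medIndex-bounds d 1≤d with medIndex E d | medIndex-cases d 1≤d
  ... | j | inj₁ (refl , refl)            = s≤s z≤n , ≤-refl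
  ... | j | inj₂ (inj₁ (_ , j+j≡1+d))     = positive (subst (2 ≤_) (sym j+j≡1+d) (s≤s 1≤d)) , ≮⇒≥ d<j
    where
    d<j : ¬ (d < j)
    d<j d<j = <-irrefl refl (begin-strict
      suc d       ≡⟨ +-identityʳ (suc d) ⟨
      suc d + 0   <⟨ +-monoʳ-< (suc d) 1≤d ⟩
      suc d + d   ≤⟨ +-mono-≤ d<j (<⇒≤ d<j) ⟩
      j + j       ≡⟨ j+j≡1+d ⟩
      suc d       ∎)
      where open ≤-Reasoning
    positive : ∀ {j} → 2 ≤ j + j → 1 ≤ j
    positive {suc j} _ = s≤s z≤n
  ... | j | inj₂ (inj₂ ((_ , 4≤d) , j+j≡d)) =
    positive (subst (4 ≤_) (sym j+j≡d) 4≤d) , subst (j ≤_) j+j≡d (m≤m+n j j)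
    where
    positive : ∀ {j} → 4 ≤ j + j → 1 ≤ j
    positive {suc j} _ = s≤s z≤n

  odd-not-two : ∀ {d} → Odd E d → d ≢ 2
  odd-not-two (oddSS ()) refl

  two-not-4⊕ : ∀ {d} → d ≡ 2 → ¬ (¬ Odd E d × 4 ≤ d)
  two-not-4⊕ refl (_ , s≤s (s≤s ()))

  -- L and R count the neighbours strictly below and strictly above the median
  -- of a vertex of degree d = L + 1 + R.
  data MedianSplit (d L R : ℕ) : Set where
    two  : d ≡ 2 → L ≡ 1 → R ≡ 0 → MedianSplit d L R
    odd  : Odd E d → L ≡ R → MedianSplit d L R
    even : ¬ Odd E d → 4 ≤ d → 1 ≤ L → suc L ≡ R → MedianSplit d L R

  medIndex-split : ∀ {d L R} → d ≡ R + suc L → medIndex E d ≡ suc L → MedianSplit d L R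
  medIndex-split {d} {L} {R} refl j≡1+L with medIndex-cases d (≤-trans (s≤s z≤n) (m≤n+m (suc L) R))
  ... | inj₁ (d≡2 , j≡2) = two d≡2 L≡1 (+-cancelʳ-≡ (suc L) R 0 (trans d≡2 (cong suc (sym L≡1))))
    where
    L≡1 : L ≡ 1
    L≡1 = suc-injective (trans (sym j≡1+L) j≡2)
  ... | inj₂ (inj₁ (o , j+j≡1+d)) =
    odd o (+-cancelʳ-≡ (suc L) L R (suc-injective (subst (λ j → j + j ≡ suc d) j≡1+L j+j≡1+d)))
  ... | inj₂ (inj₂ ((¬o , 4≤d) , j+j≡d)) = even ¬o 4≤d (positive (subst (4 ≤_) (sym 2L+2≡d) 4≤d)) 
    (+-cancelʳ-≡ (suc L) (suc L) R 2L+2≡d)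
    where
    2L+2≡d : suc L + suc L ≡ d
    2L+2≡d = subst (λ j → j + j ≡ d) j≡1+L j+j≡d
    positive : ∀ {L} → 4 ≤ suc L + suc L → 1 ≤ L
    positive {zero}  (s≤s (s≤s ()))
    positive {suc L} _ = s≤s z≤n

  module _ {d L R : ℕ} where

    R≤1+L : MedianSplit d L R → R ≤ suc L
    R≤1+L (two _ refl refl) = z≤n
    R≤1+L (odd _ refl)      = n≤1+n L
    R≤1+L (even _ _ _ refl) = ≤-refl

    L≤1+R : MedianSplit d L R → L ≤ suc R
    L≤1+R (two _ refl refl) = ≤-refl
    L≤1+R (odd _ refl)      = n≤1+n L
    L≤1+R (even _ _ _ refl) = ≤-trans (n≤1+n L) (n≤1+n (suc L))

    L≤R : d ≢ 2 → MedianSplit d L R → L ≤ R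
    L≤R d≢2 (two d≡2 _ _)   = ⊥-elim (d≢2 d≡2)
    L≤R _   (odd _ refl)      = ≤-refl
    L≤R _   (even _ _ _ refl) = n≤1+n L

    R≤L : ¬ (¬ Odd E d × 4 ≤ d) → MedianSplit d L R → R ≤ L
    R≤L _    (two _ refl refl)    = z≤n
    R≤L _    (odd _ refl)         = ≤-refl
    R≤L ¬4⊕ (even ¬odd 4≤d _ _) = ⊥-elim (¬4⊕ (¬odd , 4≤d))

    1≤R⇒1≤L : 1 ≤ R → MedianSplit d L R → 1 ≤ L
    1≤R⇒1≤L _   (two _ refl _)  = ≤-refl
    1≤R⇒1≤L 1≤R (odd _ refl)    = 1≤R
    1≤R⇒1≤L _   (even _ _ 1≤L _) = 1≤L

    L≡1 : d ≡ 2 → MedianSplit d L R → L ≡ 1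
    L≡1 _    (two _ L≡1 _)      = L≡1
    L≡1 refl (odd (oddSS ()) _)
    L≡1 refl (even _ (s≤s (s≤s ())) _ _)

isEdge : ∀ {m n} → Network m n → Fin m × Fin n → Bool
isEdge E (x , z) = E x z

module _ {m n : ℕ} (E : Network m n) (πX : LinOrder m) where

  -- Neighbours on either side of a rank

  adj : Fin n → Fin m → Bool
  adj z x = E x z

  ranked-< ranked-> ranked-≡ : ℕ → Fin m → Bool
  ranked-< t x = rank πX x <ᵇ t
  ranked-> t x = t <ᵇ rank πX x
  ranked-≡ t x = rank πX x ≡ᵇ t

  below above at : Fin n → ℕ → ℕ
  below z t = count (λ x → adj z x ∧ ranked-< t x)
  above z t = count (λ x → adj z x ∧ ranked-> t x)
  at    z t = count (λ x → adj z x ∧ ranked-≡ t x)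

  deg≡count : ∀ z → deg E z ≡ count (adj z)
  deg≡count z = length-filterᵇ-tabulate (adj z) id

  nbPos≡below : ∀ z x → nbPos E πX z x ≡ below z (suc (rank πX x))
  nbPos≡below z x = trans (length-filterᵇ-tabulate (λ x′ → E x′ z ∧ (x′ ≤ᵇ[ πX ] x)) id)
    (sum-cong-≗ (λ x′ → cong (λ b → ind (E x′ z ∧ b)) (≤ᵇ≡<ᵇ-suc (rank πX x′) (rank πX x))))

  above+below≡deg : ∀ z t → above z t + below z (suc t) ≡ deg E z
  above+below≡deg z t = begin
    above z t + below z (suc t)  ≡⟨ count-∧-split (adj z) (ranked-> t) (ranked-< (suc t)) (λ _ → true)
                                      (λ x → <ᵇ-dichotomy t (rank πX x)) ⟩
    count (λ x → adj z x ∧ true) ≡⟨ sum-cong-≗ (λ x → cong ind (∧-identityʳ (E x z))) ⟩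
    count (adj z)                ≡⟨ deg≡count z ⟨
    deg E z                      ∎
    where open ≡-Reasoning

  below+at≡below-suc : ∀ z t → below z t + at z t ≡ below z (suc t)
  below+at≡below-suc z t =
    count-∧-split (adj z) (ranked-< t) (ranked-≡ t) (ranked-< (suc t)) (λ x → <ᵇ-suc-split (rank πX x) t)

  at≤1 : ∀ z t → at z t ≤ 1
  at≤1 z t = count-unique _ (λ x x′ hx hx′ → rank-injective πX (trans (rank≡t hx) (sym (rank≡t hx′))))
    where
    rank≡t : ∀ {x} → T (adj z x ∧ ranked-≡ t x) → rank πX x ≡ t
    rank≡t h = ≡ᵇ⇒≡ _ _ (proj₂ (Equivalence.to T-∧ h))

  below-suc-≤ : ∀ z t → below z (suc t) ≤ suc (below z t)
  below-suc-≤ z t = begin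
    below z (suc t)        ≡⟨ below+at≡below-suc z t ⟨
    below z t + at z t     ≤⟨ +-monoʳ-≤ (below z t) (at≤1 z t) ⟩
    below z t + 1          ≡⟨ +-comm (below z t) 1 ⟩
    suc (below z t)        ∎
    where open ≤-Reasoning

  below-suc-neighbour : ∀ {z x} → T (E x z) → below z (suc (rank πX x)) ≡ suc (below z (rank πX x))
  below-suc-neighbour {z} {x} e = ≤-antisym (below-suc-≤ z r) (begin
    suc (below z r)        ≡⟨ +-comm 1 _ ⟩
    below z r + 1          ≤⟨ +-monoʳ-≤ _ (count-∧-witness (adj z) (ranked-≡ r) x e (≡⇒≡ᵇ r r refl)) ⟩
    below z r + at z r     ≡⟨ below+at≡below-suc z r ⟩
    below z (suc r)        ∎)
    where
    open ≤-Reasoning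
    r = rank πX x

  below-mono : ∀ z {s t} → s ≤ t → below z s ≤ below z t
  below-mono z {s} {t} s≤t = count-∧-mono (adj z) (λ x h → <⇒<ᵇ (<-≤-trans (<ᵇ⇒< (rank πX x) s h) s≤t))

  above-antimono : ∀ z {s t} → s ≤ t → above z t ≤ above z s
  above-antimono z {s} {t} s≤t = count-∧-mono (adj z) (λ x h → <⇒<ᵇ (≤-<-trans s≤t (<ᵇ⇒< t (rank πX x) h)))

  below-positive : ∀ z t → 1 ≤ below z t → ∃ λ x → T (E x z) × rank πX x < t
  below-positive z t 1≤below with count-∧-positive (adj z) (ranked-< t) 1≤below
  ... | x , e , h = x , e , <ᵇ⇒< (rank πX x) t h

  above-positive : ∀ z t → 1 ≤ above z t → ∃ λ x → T (E x z) × t < rank πX x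
  above-positive z t 1≤above with count-∧-positive (adj z) (ranked-> t) 1≤above
  ... | x , e , h = x , e , <ᵇ⇒< t (rank πX x) h

  below-witness : ∀ {z x t} → T (E x z) → rank πX x < t → 1 ≤ below z t
  below-witness {z} {x} {t} e x<t = count-∧-witness (adj z) (ranked-< t) x e (<⇒<ᵇ x<t)

  above-witness : ∀ {z x t} → T (E x z) → t < rank πX x → 1 ≤ above z t
  above-witness {z} {x} {t} e t<x = count-∧-witness (adj z) (ranked-> t) x e (<⇒<ᵇ t<x)

  below-zero : ∀ z → below z 0 ≡ 0
  below-zero z = n<1⇒n≡0 (≰⇒> nothing-below)
    where
    nothing-below : ¬ (1 ≤ below z 0)
    nothing-below 1≤below with below-positive z 0 1≤below
    ... | _ , _ , ()

  deg≤below-all : ∀ z → deg E z ≤ below z m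
  deg≤below-all z = subst (_≤ below z m) (sym (deg≡count z))
    (count-mono {p = adj z} (λ x e → Equivalence.from T-∧ (e , <⇒<ᵇ (toℕ<n (πX ⟨$⟩ʳ x)))))

  median-exists : ∀ z → 1 ≤ deg E z → ∃ λ M → IsMed E πX z M
  median-exists z 1≤d with medIndex-bounds E (deg E z) 1≤d
  ... | 1≤j , j≤d
    with discrete-ivt (below z) (below-suc-≤ z) m (subst (_< medIndex E (deg E z)) (sym (below-zero z)) 1≤j)
                      (≤-trans j≤d (deg≤below-all z))
  ... | s , below<j , below-suc≡j with count-∧-positive (adj z) (ranked-≡ s) 1≤at
    where
    1≤at : 1 ≤ at z s
    1≤at = +-cancelˡ-≤ (below z s) 1 (at z s) (begin
      below z s + 1          ≡⟨ +-comm (below z s) 1 ⟩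
      suc (below z s)        ≤⟨ below<j ⟩
      medIndex E (deg E z)   ≡⟨ below-suc≡j ⟨
      below z (suc s)        ≡⟨ below+at≡below-suc z s ⟨
      below z s + at z s     ∎)
      where open ≤-Reasoning
  ... | x , e , rank≡s =
    x , e , trans (nbPos≡below z x) (trans (cong (below z ∘ suc) (≡ᵇ⇒≡ _ _ rank≡s)) below-suc≡j)

  median-split : ∀ {z M} → IsMed E πX z M → MedianSplit E (deg E z) (below z (rank πX M)) (above z (rank πX M))
  median-split {z} {M} (e , pos≡j) = medIndex-split E
    (trans (sym (above+below≡deg z r)) (cong (above z r +_) (below-suc-neighbour e)))
    (trans (sym pos≡j) (trans (nbPos≡below z M) (below-suc-neighbour e)))
    where
    r = rank πX M

  module _ {z : Fin n} {M : Fin m} (med : IsMed E πX z M) where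

    private
      r = rank πX M
      below-suc-median : below z (suc r) ≡ suc (below z r)
      below-suc-median = below-suc-neighbour (proj₁ med)

    deg≡above+1+below : deg E z ≡ above z r + suc (below z r)
    deg≡above+1+below = trans (sym (above+below≡deg z r)) (cong (above z r +_) below-suc-median)

    1+below≤below-past-median : ∀ {t} → r < t → suc (below z r) ≤ below z t
    1+below≤below-past-median {t} r<t = subst (_≤ below z t) below-suc-median (below-mono z r<t)

    1+above≤above-before-median : ∀ {t} → t < r → suc (above z r) ≤ above z t
    1+above≤above-before-median {t} t<r = +-cancelʳ-≤ (below z r) _ _ (begin
      suc (above z r) + below z r   ≡⟨ +-suc (above z r) (below z r) ⟨
      above z r + suc (below z r)   ≡⟨ deg≡above+1+below ⟨
      deg E z                       ≡⟨ above+below≡deg z t ⟨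
      above z t + below z (suc t)   ≤⟨ +-monoʳ-≤ (above z t) (below-mono z t<r) ⟩
      above z t + below z r         ∎)
      where open ≤-Reasoning

    above≤below-past-median : ∀ {t} → r < t → above z t ≤ below z t
    above≤below-past-median {t} r<t = begin
      above z t         ≤⟨ above-antimono z (<⇒≤ r<t) ⟩
      above z r         ≤⟨ R≤1+L E (median-split med) ⟩
      suc (below z r)   ≤⟨ 1+below≤below-past-median r<t ⟩
      below z t         ∎
      where open ≤-Reasoning

    below≤above-before-median : ∀ {t} → t < r → below z t ≤ above z t
    below≤above-before-median {t} t<r = begin
      below z t         ≤⟨ below-mono z (<⇒≤ t<r) ⟩
      below z r         ≤⟨ L≤1+R E (median-split med) ⟩
      suc (above z r)   ≤⟨ 1+above≤above-before-median t<r ⟩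
      above z t         ∎
      where open ≤-Reasoning

    deg≤2*below-past-median : ∀ {t} → r < t → deg E z ≤ 2 * below z t
    deg≤2*below-past-median {t} r<t = begin
      deg E z                              ≡⟨ deg≡above+1+below ⟩
      above z r + suc (below z r)          ≤⟨ +-monoˡ-≤ _ (R≤1+L E (median-split med)) ⟩
      suc (below z r) + suc (below z r)    ≤⟨ +-mono-≤ (1+below≤below-past-median r<t)
                                                      (1+below≤below-past-median r<t) ⟩
      below z t + below z t                ≡⟨ cong (below z t +_) (+-identityʳ (below z t)) ⟨
      2 * below z t                        ∎
      where open ≤-Reasoning

    deg≤2*above-before-median : ∀ {t} → t < r → deg E z ≤ 2 * above z t
    deg≤2*above-before-median {t} t<r = begin
      deg E z                              ≡⟨ deg≡above+1+below ⟩
      above z r + suc (below z r)          ≤⟨ +-monoʳ-≤ (above z r) (s≤s (L≤1+R E (median-split med))) ⟩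
      above z r + suc (suc (above z r))    ≡⟨ +-suc (above z r) (suc (above z r)) ⟩
      suc (above z r) + suc (above z r)    ≤⟨ +-mono-≤ (1+above≤above-before-median t<r)
                                                      (1+above≤above-before-median t<r) ⟩
      above z t + above z t                ≡⟨ cong (above z t +_) (+-identityʳ (above z t)) ⟨
      2 * above z t                        ∎
      where open ≤-Reasoning

    deg≤2*below-median : Is2 E z → deg E z ≤ 2 * below z r
    deg≤2*below-median z₂ = ≤-reflexive (begin
      deg E z           ≡⟨ z₂ ⟩
      2 * 1             ≡⟨ cong (2 *_) (L≡1 E z₂ (median-split med)) ⟨
      2 * below z r     ∎)
      where open ≡-Reasoning

  -- For the median M of y and a neighbour a of y, the neighbour c lies on the
  -- other side of M than a, except where the class of y forces otherwise.
  data Companion (y : Fin n) (M a c : Fin m) : Set where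
    opposite-above : a <[ πX ] M → M <[ πX ] c → Companion y M a c
    opposite-below : M <[ πX ] a → c <[ πX ] M → Companion y M a c
    two-heavy      : Is2 E y → a <[ πX ] M → c ≡ M → Companion y M a c
    two-median     : Is2 E y → a ≡ M → c <[ πX ] M → Companion y M a c
    odd-median     : IsOdd E y → a ≡ M → Companion y M a c
    even-median    : Is4⊕ E y → a ≡ M → M <[ πX ] c → Companion y M a c

  module _ {y : Fin n} {M a : Fin m} where

    private
      Companion-of-neighbour : Set
      Companion-of-neighbour = ∃ λ c → T (E c y) × Companion y M a c

      from-above : 1 ≤ above y (rank πX M) → (∀ {c} → M <[ πX ] c → Companion y M a c) → Companion-of-neighbour
      from-above 1≤above companion with above-positive y (rank πX M) 1≤above
      ... | c , ec , M<c = c , ec , companion M<c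

      from-below : 1 ≤ below y (rank πX M) → (∀ {c} → c <[ πX ] M → Companion y M a c) → Companion-of-neighbour
      from-below 1≤below companion with below-positive y (rank πX M) 1≤below
      ... | c , ec , c<M = c , ec , companion c<M

    companion-exists : IsMed E πX y M → T (E a y) → ∃ λ c → T (E c y) × Companion y M a c
    companion-exists med e with <-cmp (rank πX a) (rank πX M) | median-split med
    ... | tri> _ _ M<a | split      = from-below (1≤R⇒1≤L E (above-witness e M<a) split) (opposite-below M<a)
    ... | tri< a<M _ _ | two y₂ _ _ = M , proj₁ med , two-heavy y₂ a<M refl
    ... | tri< a<M _ _ | odd _ L≡R  = from-above (subst (1 ≤_) L≡R (below-witness e a<M)) (opposite-above a<M)
    ... | tri< a<M _ _ | even _ _ _ 1+L≡R = from-above (subst (1 ≤_) 1+L≡R (s≤s z≤n)) (opposite-above a<M)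
    ... | tri≈ _ a≈M _ | two y₂ L≡1 _ = from-below (≤-reflexive (sym L≡1)) (two-median y₂ (rank-injective πX a≈M))
    ... | tri≈ _ a≈M _ | odd y-odd _  = a , e , odd-median y-odd (rank-injective πX a≈M)
    ... | tri≈ _ a≈M _ | even ¬odd 4≤d _ 1+L≡R =
      from-above (subst (1 ≤_) 1+L≡R (s≤s z≤n)) (even-median (¬odd , 4≤d) (rank-injective πX a≈M))

  above≤deg : ∀ z t → above z t ≤ deg E z
  above≤deg z t = subst (above z t ≤_) (above+below≡deg z t) (m≤m+n _ _)

  below≤deg : ∀ z t → below z t ≤ deg E z
  below≤deg z t = ≤-trans (below-mono z (n≤1+n t)) (subst (below z (suc t) ≤_) (above+below≡deg z t) (m≤n+m _ _))

  -- Crossings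

  crossingsAt : LinOrder n → Fin m → Fin n → Fin n → ℕ
  crossingsAt πY a y z = count (λ x → adj z x ∧ crosses E πX πY (a , y) (x , z))

  crossCount≡sum-crossingsAt : ∀ πY a y → crossCount E πX πY (a , y) ≡ sum (crossingsAt πY a y)
  crossCount≡sum-crossingsAt πY a y = begin
    length (filterᵇ (crosses E πX πY (a , y)) (filterᵇ (isEdge E) (pairs E)))
      ≡⟨ cong length (filterᵇ-filterᵇ (isEdge E) (crosses E πX πY (a , y)) (pairs E)) ⟩
    length (filterᵇ (λ e → isEdge E e ∧ crosses E πX πY (a , y) e) (pairs E))
      ≡⟨ length-filterᵇ-cartesianProduct (λ e → isEdge E e ∧ crosses E πX πY (a , y) e) id id ⟩
    sum (λ x → sum (λ z → ind (E x z ∧ crosses E πX πY (a , y) (x , z))))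
      ≡⟨ ∑-comm (λ x z → ind (E x z ∧ crosses E πX πY (a , y) (x , z))) ⟩
    sum (crossingsAt πY a y)
      ∎
    where open ≡-Reasoning

  crossingsAt-before : ∀ πY {a y z} → z <[ πY ] y → crossingsAt πY a y z ≡ above z (rank πX a)
  crossingsAt-before πY {a} {y} {z} z<y = sum-cong-≗ (λ x → cong (λ b → ind (E x z ∧ b)) (crosses≡ x))
    where
    crosses≡ : ∀ x → crosses E πX πY (a , y) (x , z) ≡ ranked-> (rank πX a) x
    crosses≡ x rewrite <ᵇ-true z<y | <ᵇ-false (<⇒≤ z<y)
      | ∧-identityʳ (a <ᵇ[ πX ] x) | ∧-zeroʳ (x <ᵇ[ πX ] a) = ∨-identityʳ _

  crossingsAt-after : ∀ πY {a y z} → y <[ πY ] z → crossingsAt πY a y z ≡ below z (rank πX a)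
  crossingsAt-after πY {a} {y} {z} y<z = sum-cong-≗ (λ x → cong (λ b → ind (E x z ∧ b)) (crosses≡ x))
    where
    crosses≡ : ∀ x → crosses E πX πY (a , y) (x , z) ≡ ranked-< (rank πX a) x
    crosses≡ x rewrite <ᵇ-true y<z | <ᵇ-false (<⇒≤ y<z)
      | ∧-identityʳ (x <ᵇ[ πX ] a) | ∧-zeroʳ (a <ᵇ[ πX ] x) = refl

  crossingsAt-self : ∀ πY a y → crossingsAt πY a y y ≡ 0
  crossingsAt-self πY a y = begin
    crossingsAt πY a y y           ≡⟨ sum-cong-≗ (λ x → cong (λ b → ind (E x y ∧ b)) (crosses≡ x)) ⟩
    count (λ x → adj y x ∧ false)  ≡⟨ sum-cong-≗ (λ x → cong ind (∧-zeroʳ (E x y))) ⟩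
    sum {m} (λ _ → 0)              ≡⟨ sum-replicate-zero m ⟩
    0                              ∎
    where
    open ≡-Reasoning
    crosses≡ : ∀ x → crosses E πX πY (a , y) (x , y) ≡ false
    crosses≡ x rewrite <ᵇ-false {rank πY y} ≤-refl | ∧-zeroʳ (a <ᵇ[ πX ] x) | ∧-zeroʳ (x <ᵇ[ πX ] a) = refl

  module _ (πY : LinOrder n) (H : HeuristicAOutput E πX πY) where

    median-monotone : ∀ {y z My Mz} → IsMed E πX y My → IsMed E πX z Mz → z <[ πY ] y → rank πX Mz ≤ rank πX My
    median-monotone {y} {z} {My} {Mz} my mz z<y = ≮⇒≥ (λ My<Mz → <-asym z<y (proj₁ (H y z My Mz my mz) My<Mz))

    two-precedes : ∀ {y z M} → IsMed E πX y M → IsMed E πX z M → Is2 E y → ¬ Is2 E z → y <[ πY ] z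
    two-precedes {y} {z} {M} my mz y₂ ¬z₂ with median-split mz
    ... | two z₂ _ _        = ⊥-elim (¬z₂ z₂)
    ... | odd z-odd _       = proj₁ (proj₂ (H y z M M my mz)) refl y₂ z-odd
    ... | even ¬odd 4≤d _ _ = proj₁ (proj₂ (proj₂ (H y z M M my mz))) refl y₂ (¬odd , 4≤d)

    odd-precedes-4⊕ : ∀ {y z M} → IsMed E πX y M → IsMed E πX z M → IsOdd E y → Is4⊕ E z → y <[ πY ] z
    odd-precedes-4⊕ {y} {z} {M} my mz = proj₁ (proj₂ (proj₂ (proj₂ (H y z M M my mz)))) refl

    precedes-two⇒two : ∀ {y z M} → IsMed E πX y M → IsMed E πX z M → Is2 E y → z <[ πY ] y → Is2 E z
    precedes-two⇒two my mz y₂ z<y with deg E _ ≟ 2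
    ... | yes z₂ = z₂
    ... | no ¬z₂ = ⊥-elim (<-asym z<y (two-precedes my mz y₂ ¬z₂))

    before-dichotomy : ∀ {y z My Mz a c} → IsMed E πX y My → IsMed E πX z Mz → Companion y My a c → z <[ πY ] y →
      above z (rank πX a) ≤ below z (rank πX a) ⊎ deg E z ≤ 2 * below z (rank πX c)
    before-dichotomy my mz (opposite-above _ My<c) z<y =
      inj₂ (deg≤2*below-past-median mz (≤-<-trans (median-monotone my mz z<y) My<c))
    before-dichotomy my mz (opposite-below My<a _) z<y =
      inj₁ (above≤below-past-median mz (≤-<-trans (median-monotone my mz z<y) My<a))
    before-dichotomy my mz (two-heavy y₂ _ refl) z<y with rank-≤⇒<⊎≡ πX (median-monotone my mz z<y)
    ... | inj₁ Mz<My = inj₂ (deg≤2*below-past-median mz Mz<My)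
    ... | inj₂ refl  = inj₂ (deg≤2*below-median mz (precedes-two⇒two my mz y₂ z<y))
    before-dichotomy my mz (two-median y₂ refl _) z<y with rank-≤⇒<⊎≡ πX (median-monotone my mz z<y)
    ... | inj₁ Mz<My = inj₁ (above≤below-past-median mz Mz<My)
    ... | inj₂ refl  = inj₁ (R≤L E (two-not-4⊕ E (precedes-two⇒two my mz y₂ z<y)) (median-split mz))
    before-dichotomy my mz (odd-median y-odd refl) z<y with rank-≤⇒<⊎≡ πX (median-monotone my mz z<y)
    ... | inj₁ Mz<My = inj₁ (above≤below-past-median mz Mz<My)
    ... | inj₂ refl  = inj₁ (R≤L E (λ z₄ → <-asym z<y (odd-precedes-4⊕ my mz y-odd z₄)) (median-split mz))
    before-dichotomy my mz (even-median _ refl My<c) z<y =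
      inj₂ (deg≤2*below-past-median mz (≤-<-trans (median-monotone my mz z<y) My<c))

    after-dichotomy : ∀ {y z My Mz a c} → IsMed E πX y My → IsMed E πX z Mz → Companion y My a c → y <[ πY ] z →
      below z (rank πX a) ≤ above z (rank πX a) ⊎ deg E z ≤ 2 * above z (rank πX c)
    after-dichotomy my mz (opposite-above a<My _) y<z =
      inj₁ (below≤above-before-median mz (<-≤-trans a<My (median-monotone mz my y<z)))
    after-dichotomy my mz (opposite-below _ c<My) y<z =
      inj₂ (deg≤2*above-before-median mz (<-≤-trans c<My (median-monotone mz my y<z)))
    after-dichotomy my mz (two-heavy _ a<My _) y<z =
      inj₁ (below≤above-before-median mz (<-≤-trans a<My (median-monotone mz my y<z)))
    after-dichotomy my mz (two-median _ _ c<My) y<z =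
      inj₂ (deg≤2*above-before-median mz (<-≤-trans c<My (median-monotone mz my y<z)))
    after-dichotomy my mz (odd-median y-odd refl) y<z with rank-≤⇒<⊎≡ πX (median-monotone mz my y<z)
    ... | inj₁ My<Mz = inj₁ (below≤above-before-median mz My<Mz)
    ... | inj₂ refl  = inj₁ (L≤R E (λ z₂ → <-asym y<z (two-precedes mz my z₂ (odd-not-two E y-odd))) (median-split mz))
    after-dichotomy my mz (even-median y₄ refl _) y<z with rank-≤⇒<⊎≡ πX (median-monotone mz my y<z)
    ... | inj₁ My<Mz = inj₁ (below≤above-before-median mz My<Mz)
    ... | inj₂ refl  =
      inj₁ (L≤R E (λ z₂ → <-asym y<z (two-precedes mz my z₂ (λ y₂ → two-not-4⊕ E y₂ y₄))) (median-split mz))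

    crossingsAt-bound : ∀ πO {y z My Mz a c} → IsMed E πX y My → IsMed E πX z Mz → Companion y My a c →
      crossingsAt πY a y z ≤ crossingsAt πO a y z + 2 * crossingsAt πO c y z
    crossingsAt-bound πO {y} {z} {a = a} {c} my mz comp with <-cmp (rank πY z) (rank πY y) | <-cmp (rank πO z) (rank πO y)
    ... | tri≈ _ z≈y _ | _ rewrite rank-injective πY z≈y | crossingsAt-self πY a y = z≤n
    ... | tri< z<y _ _ | tri< z<′y _ _ rewrite crossingsAt-before πY {a} z<y | crossingsAt-before πO {a} z<′y = m≤m+n _ _
    ... | tri< z<y _ _ | tri≈ _ z≈′y _ = ⊥-elim (<-irrefl (cong (rank πY) (rank-injective πO z≈′y)) z<y)
    ... | tri< z<y _ _ | tri> _ _ y<′z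
      rewrite crossingsAt-before πY {a} z<y | crossingsAt-after πO {a} y<′z | crossingsAt-after πO {c} y<′z =
      dichotomy-bound {w = below z (rank πX c)} (above≤deg z (rank πX a)) (before-dichotomy my mz comp z<y)
    ... | tri> _ _ y<z | tri> _ _ y<′z rewrite crossingsAt-after πY {a} y<z | crossingsAt-after πO {a} y<′z = m≤m+n _ _
    ... | tri> _ _ y<z | tri≈ _ z≈′y _ = ⊥-elim (<-irrefl (cong (rank πY) (sym (rank-injective πO z≈′y))) y<z)
    ... | tri> _ _ y<z | tri< z<′y _ _
      rewrite crossingsAt-after πY {a} y<z | crossingsAt-before πO {a} z<′y | crossingsAt-before πO {c} z<′y =
      dichotomy-bound {w = above z (rank πX c)} (below≤deg z (rank πX a)) (after-dichotomy my mz comp y<z)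

    crossCount-bound : (∀ z → 1 ≤ deg E z) → ∀ πO {y My a c} → IsMed E πX y My → Companion y My a c →
      crossCount E πX πY (a , y) ≤ crossCount E πX πO (a , y) + 2 * crossCount E πX πO (c , y)
    crossCount-bound nonIsolated πO {y} {My} {a} {c} my comp = begin
      crossCount E πX πY (a , y)
        ≡⟨ crossCount≡sum-crossingsAt πY a y ⟩
      sum (crossingsAt πY a y)
        ≤⟨ sum-mono-≤ (λ z → crossingsAt-bound πO my (proj₂ (median-exists z (nonIsolated z))) comp) ⟩
      sum (λ z → crossingsAt πO a y z + 2 * crossingsAt πO c y z)
        ≡⟨ sum-+-2* (crossingsAt πO a y) (crossingsAt πO c y) ⟩
      sum (crossingsAt πO a y) + 2 * sum (crossingsAt πO c y)
        ≡⟨ cong₂ (λ u v → u + 2 * v) (crossCount≡sum-crossingsAt πO a y) (crossCount≡sum-crossingsAt πO c y) ⟨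
      crossCount E πX πO (a , y) + 2 * crossCount E πX πO (c , y)
        ∎
      where open ≤-Reasoning

module _ {m n : ℕ} (E : Network m n) (πX : LinOrder m) where

  edge-∈ : ∀ {a y} → T (E a y) → (a , y) ∈ edges E
  edge-∈ {a} {y} e = ∈-filter⁺ (T? ∘ isEdge E) (∈-cartesianProduct⁺ (∈-allFin a) (∈-allFin y)) e

  ∈-edge : ∀ {a y} → (a , y) ∈ edges E → T (E a y)
  ∈-edge = proj₂ ∘ ∈-filter⁻ (T? ∘ isEdge E) {xs = pairs E}

  crossCount≤localCrossingNumber : ∀ πY {a y} → T (E a y) → crossCount E πX πY (a , y) ≤ localCrossingNumber E πX πY
  crossCount≤localCrossingNumber πY e = foldr-⊔-upper (crossCount E πX πY) (edges E) (edge-∈ e)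

  localCrossingNumber-lub : ∀ πY {b} → (∀ {a y} → T (E a y) → crossCount E πX πY (a , y) ≤ b) →
    localCrossingNumber E πX πY ≤ b
  localCrossingNumber-lub πY ≤b = foldr-⊔-lub (crossCount E πX πY) (edges E) (λ {(a , y)} e∈ → ≤b (∈-edge e∈))

theorem2 : ∀ {m n : ℕ} (E : Network m n) (πX : LinOrder m) (k : ℕ) →
    (∀ (y : Fin n) → 1 ≤ deg E y) →
    OneSidedLCN E πX k →
    ∀ (πY : LinOrder n) → HeuristicAOutput E πX πY →
    localCrossingNumber E πX πY ≤ 3 * k
theorem2 E πX k nonIsolated ((πO , lcn≡k) , _) πY H = localCrossingNumber-lub E πX πY bound
  where
  optimal : ∀ {a y} → T (E a y) → crossCount E πX πO (a , y) ≤ k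
  optimal e = subst (_ ≤_) lcn≡k (crossCount≤localCrossingNumber E πX πO e)
  bound : ∀ {a y} → T (E a y) → crossCount E πX πY (a , y) ≤ 3 * k
  bound {a} {y} e =
    let My , my       = median-exists E πX y (nonIsolated y)
        c , ec , comp = companion-exists E πX my e
    in begin
      crossCount E πX πY (a , y)
        ≤⟨ crossCount-bound E πX πY H nonIsolated πO my comp ⟩
      crossCount E πX πO (a , y) + 2 * crossCount E πX πO (c , y)
        ≤⟨ +-mono-≤ (optimal e) (*-monoʳ-≤ 2 (optimal ec)) ⟩
      k + 2 * k
        ≡⟨⟩
      3 * k
        ∎
    where open ≤-Reasoning
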